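{- First-order logic extended with probabilistic inclusion atoms $\vec x\leq\vec y$ and inclusion atoms $\vec x\subseteq\vec y$ is union closed under (lax) multiteam semantics.
   Context: Setting: (lax) multiteam semantics. A multiteam $(X,m)$ is a team $X$ with a multiplicity function $m\colon X\to\mathbb N$; $|(X,m)|=\sum_s m(s)$, and $(X,m)_{\vec x=\vec a}$ keeps multiplicities of assignments $s$ with $s(\vec x)=\vec a$ and sets others to $0$. The probabilistic inclusion atom $\vec x\leq\vec y$ holds in $(X,m)$ iff $|(X,m)_{\vec x=s(\vec x)}|\le|(X,m)_{\vec y=s(\vec x)}|$ for all assignments $s$ of $\vec x$; the inclusion atom $\vec x\subseteq\vec y$ holds iff for every $s$ with $m(s)\ge1$ there is $s'$ with $m(s')\ge1$ and $s(\vec x)=s'(\vec y)$. The disjoint union $(X,m)\uplus(Y,n)$ is the multiset on $X\cup Y$ with multiplicities added. A formula $\varphi$ is union closed if for all multistructures $\mathfrak A$ and multiteams $(X,m),(Y,n)$, $\mathfrak A\models_{(X,m)}\varphi$ and $\mathfrak A\models_{(Y,n)}\varphi$ imply $\mathfrak A\models_{(X,m)\uplus(Y,n)}\varphi$; a logic is union closed if all its formulas are. -}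

module Defs where

open import Data.Nat using (ℕ; suc; _≤_; _≟_)
open import Data.Fin using (Fin)
import Data.Fin.Properties as FinP
open import Data.Fin.Subset using (Subset; Nonempty)
open import Data.Fin.Subset.Properties using (_∈?_)
open import Data.Vec using (Vec; []; _∷_)
import Data.Vec as Vec
open import Data.Vec.Properties using (≡-dec)
open import Data.List using (List; []; _∷_; _++_; length; filter; concatMap; allFin; lookup)
import Data.List as List
open import Data.List.Relation.Unary.All using (All)
open import Data.List.Relation.Unary.Any using (Any)
open import Data.List.Relation.Binary.Permutation.Propositional using (_↭_)
open import Data.Product using (Σ; ∃; ∃-syntax; _×_; _,_)
open import Relation.Binary.PropositionalEquality using (_≡_)
open import Relation.Nullary using (¬_; yes; no)

record Signature : Set₁ where
  field
    Fun      : Set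
    funArity : Fun → ℕ
    Rel      : Set
    relArity : Rel → ℕ
open Signature public

Var : Set
Var = ℕ

data Term (σ : Signature) : Set where
  var : Var → Term σ
  app : (f : Fun σ) → Vec (Term σ) (funArity σ f) → Term σ

data Formula (σ : Signature) : Set where
  rel   : (R : Rel σ) → Vec (Term σ) (relArity σ R) → Formula σ
  nrel  : (R : Rel σ) → Vec (Term σ) (relArity σ R) → Formula σ
  eq    : Term σ → Term σ → Formula σ
  neq   : Term σ → Term σ → Formula σ
  pincl : ∀ {k} → Vec Var k → Vec Var k → Formula σ
  incl  : ∀ {k} → Vec Var k → Vec Var k → Formula σ
  _∧'_  : Formula σ → Formula σ → Formula σ
  _∨'_  : Formula σ → Formula σ → Formula σ
  ex    : Var → Formula σ → Formula σ
  all   : Var → Formula σ → Formula σ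

record Structure (σ : Signature) : Set₁ where
  field
    size : ℕ                       -- domain is Fin (suc size)
    funI : (f : Fun σ) → Vec (Fin (suc size)) (funArity σ f) → Fin (suc size)
    relI : (R : Rel σ) → Vec (Fin (suc size)) (relArity σ R) → Set
open Structure public

module _ {σ : Signature} (𝔄 : Structure σ) where

  Dom : Set
  Dom = Fin (suc (size 𝔄))

  Assignment : Set
  Assignment = Var → Dom

  -- A multiteam is a finite multiset of assignments, represented as a list
  -- (multiplicity of s = number of occurrences; order is irrelevant).
  Multiteam : Set
  Multiteam = List Assignment

  update : Assignment → Var → Dom → Assignment
  update s x a y with y ≟ x
  ... | yes _ = a
  ... | no  _ = s y

  mutual
    evalT : Assignment → Term σ → Dom
    evalT s (var x)    = s x
    evalT s (app f ts) = funI 𝔄 f (evalTs s ts)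

    evalTs : ∀ {k} → Assignment → Vec (Term σ) k → Vec Dom k
    evalTs s []       = []
    evalTs s (t ∷ ts) = evalT s t ∷ evalTs s ts

  valV : ∀ {k} → Assignment → Vec Var k → Vec Dom k
  valV s xs = Vec.map s xs

  count : ∀ {k} → Multiteam → Vec Var k → Vec Dom k → ℕ
  count X xs as = length (filter (λ s → ≡-dec FinP._≟_ (valV s xs) as) X)

  duplicate : Multiteam → Var → Multiteam
  duplicate X x = concatMap (λ s → List.map (update s x) (allFin (suc (size 𝔄)))) X

  -- (X,m)[F/x] : the i-th copy is extended by every value of the set F i (lax)
  supplement : (X : Multiteam) → Var → (Fin (length X) → Subset (suc (size 𝔄))) → Multiteam
  supplement X x F =
    concatMap (λ i → List.map (update (lookup X i) x)
                       (filter (λ a → a ∈? F i) (allFin (suc (size 𝔄)))))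
              (allFin (length X))

  _⊨_ : Multiteam → Formula σ → Set
  X ⊨ rel R ts  = All (λ s → relI 𝔄 R (evalTs s ts)) X
  X ⊨ nrel R ts = All (λ s → ¬ relI 𝔄 R (evalTs s ts)) X
  X ⊨ eq t u    = All (λ s → evalT s t ≡ evalT s u) X
  X ⊨ neq t u   = All (λ s → ¬ evalT s t ≡ evalT s u) X
  X ⊨ pincl xs ys = ∀ as → count X xs as ≤ count X ys as
  X ⊨ incl xs ys  = All (λ s → Any (λ s' → valV s xs ≡ valV s' ys) X) X
  X ⊨ (φ ∧' ψ)  = (X ⊨ φ) × (X ⊨ ψ)
  X ⊨ (φ ∨' ψ)  = ∃[ Y ] ∃[ Z ] ((X ↭ (Y ++ Z)) × (Y ⊨ φ) × (Z ⊨ ψ))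
  X ⊨ ex x φ    = ∃[ F ] ((∀ i → Nonempty (F i)) × (supplement X x F ⊨ φ))
  X ⊨ all x φ   = duplicate X x ⊨ φ

module Submission where

-- The proof is by induction on the formula, and every case reduces to a
-- fact about how the semantic operations interact with the disjoint union
-- X ++ Y of two multiteams:
--   * flat literals are checked assignment-wise, so they are preserved by ++;
--   * the counts |X_{x⃗=a⃗}| are additive in ++, so probabilistic inclusion
--     atoms are preserved since ≤ is compatible with +;
--   * an inclusion witness in X stays a witness in X ++ Y;
--   * splittings X ↭ Y₁ ++ Z₁ and Y ↭ Y₂ ++ Z₂ combine to a splitting of
--     X ++ Y by interchanging the middle blocks;
--   * duplication distributes over ++, and so does supplementation once the
--     two supplementing functions are joined position-wise.

open import Defs
open import Data.Nat using (suc; _+_; _≤_)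
open import Data.Nat.Properties using (+-mono-≤)
open import Data.Fin using (Fin; zero) renaming (suc to fsuc; _≟_ to _≟ᶠ_)
open import Data.Fin.Subset using (Subset; Nonempty)
open import Data.Fin.Subset.Properties using (_∈?_)
open import Data.Vec using (Vec)
open import Data.Vec.Properties using (≡-dec)
open import Data.List
  using (List; []; _∷_; _++_; length; lookup; allFin; map; filter; concat; concatMap; tabulate)
import Data.List.Properties as List
open import Data.List.Relation.Unary.All using (All)
import Data.List.Relation.Unary.All as All
open import Data.List.Relation.Unary.All.Properties using (++⁺)
open import Data.List.Relation.Unary.Any using (Any)
open import Data.List.Relation.Unary.Any.Properties using (++⁺ˡ; ++⁺ʳ)
open import Data.List.Relation.Binary.Permutation.Propositional using (_↭_; ↭-trans)
import Data.List.Relation.Binary.Permutation.Propositional.Properties as Perm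
open import Algebra.Bundles using (CommutativeMonoid)
import Algebra.Properties.CommutativeSemigroup as CommSemigroupProperties
open import Data.Product using (_,_)
open import Function using (_∘_)
open import Relation.Nullary using (Dec)
open import Relation.Binary.PropositionalEquality
  using (_≡_; refl; sym; cong; subst; subst₂; module ≡-Reasoning)

module _ {A : Set} where

  ++-interchange : (W X Y Z : List A) → (W ++ X) ++ (Y ++ Z) ↭ (W ++ Y) ++ (X ++ Z)
  ++-interchange = CommSemigroupProperties.interchange
    (CommutativeMonoid.commutativeSemigroup (Perm.++-commutativeMonoid {A = A}))

  allAny-++ : (R : A → A → Set) (X Y : List A)
    → All (λ s → Any (R s) X) X → All (λ s → Any (R s) Y) Y
    → All (λ s → Any (R s) (X ++ Y)) (X ++ Y)
  allAny-++ R X Y p q = ++⁺ (All.map ++⁺ˡ p) (All.map (++⁺ʳ X) q)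

  module _ {B : Set} where

    joinChoice : (X Y : List A) → (Fin (length X) → B) → (Fin (length Y) → B)
      → Fin (length (X ++ Y)) → B
    joinChoice []      Y F G i       = G i
    joinChoice (s ∷ X) Y F G zero    = F zero
    joinChoice (s ∷ X) Y F G (fsuc i) = joinChoice X Y (F ∘ fsuc) G i

    joinChoice-all : (P : B → Set) (X Y : List A)
      (F : Fin (length X) → B) (G : Fin (length Y) → B)
      → (∀ i → P (F i)) → (∀ i → P (G i)) → ∀ i → P (joinChoice X Y F G i)
    joinChoice-all P []      Y F G pF pG i       = pG i
    joinChoice-all P (s ∷ X) Y F G pF pG zero    = pF zero
    joinChoice-all P (s ∷ X) Y F G pF pG (fsuc i) =
      joinChoice-all P X Y (F ∘ fsuc) G (pF ∘ fsuc) pG i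

    module _ {C : Set} (h : A → B → List C) where

      -- Expand the element at every position of X by h, using the parameter
      -- F chosen for that position, and concatenate the results.
      -- Supplementation (X,m)[F/x] has exactly this shape.
      positionwise : (X : List A) → (Fin (length X) → B) → List C
      positionwise X F = concatMap (λ i → h (lookup X i) (F i)) (allFin (length X))

      positionwise-∷ : (s : A) (X : List A) (F : Fin (length (s ∷ X)) → B)
        → positionwise (s ∷ X) F ≡ h s (F zero) ++ positionwise X (F ∘ fsuc)
      positionwise-∷ s X F = cong (h s (F zero) ++_) (begin
        concatMap expand (tabulate fsuc)
          ≡⟨ cong concat (List.map-tabulate fsuc expand) ⟩
        concat (tabulate (expand ∘ fsuc))
          ≡⟨ cong concat (List.map-tabulate (λ i → i) (expand ∘ fsuc)) ⟨
        positionwise X (F ∘ fsuc)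
          ∎)
        where
          open ≡-Reasoning
          expand : Fin (length (s ∷ X)) → List C
          expand i = h (lookup (s ∷ X) i) (F i)

      positionwise-++ : (X Y : List A) (F : Fin (length X) → B) (G : Fin (length Y) → B)
        → positionwise (X ++ Y) (joinChoice X Y F G) ≡ positionwise X F ++ positionwise Y G
      positionwise-++ []      Y F G = refl
      positionwise-++ (s ∷ X) Y F G = begin
        positionwise (s ∷ X ++ Y) (joinChoice (s ∷ X) Y F G)
          ≡⟨ positionwise-∷ s (X ++ Y) (joinChoice (s ∷ X) Y F G) ⟩
        h s (F zero) ++ positionwise (X ++ Y) (joinChoice X Y (F ∘ fsuc) G)
          ≡⟨ cong (h s (F zero) ++_) (positionwise-++ X Y (F ∘ fsuc) G) ⟩
        h s (F zero) ++ (positionwise X (F ∘ fsuc) ++ positionwise Y G)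
          ≡⟨ List.++-assoc (h s (F zero)) _ _ ⟨
        (h s (F zero) ++ positionwise X (F ∘ fsuc)) ++ positionwise Y G
          ≡⟨ cong (_++ positionwise Y G) (positionwise-∷ s X F) ⟨
        positionwise (s ∷ X) F ++ positionwise Y G
          ∎
        where open ≡-Reasoning

module _ {σ : Signature} (𝔄 : Structure σ) where

  count-++ : ∀ {k} (X Y : Multiteam 𝔄) (xs : Vec Var k) (as : Vec (Dom 𝔄) k)
    → count 𝔄 (X ++ Y) xs as ≡ count 𝔄 X xs as + count 𝔄 Y xs as
  count-++ X Y xs as = begin
    length (filter p (X ++ Y))          ≡⟨ cong length (List.filter-++ p X Y) ⟩
    length (filter p X ++ filter p Y)   ≡⟨ List.length-++ (filter p X) ⟩
    count 𝔄 X xs as + count 𝔄 Y xs as   ∎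
    where
      open ≡-Reasoning
      p : (s : Assignment 𝔄) → Dec (valV 𝔄 s xs ≡ as)
      p s = ≡-dec _≟ᶠ_ (valV 𝔄 s xs) as

  pincl-++ : ∀ {k} (X Y : Multiteam 𝔄) (xs ys : Vec Var k)
    → _⊨_ 𝔄 X (pincl xs ys) → _⊨_ 𝔄 Y (pincl xs ys) → _⊨_ 𝔄 (X ++ Y) (pincl xs ys)
  pincl-++ X Y xs ys p q as =
    subst₂ _≤_ (sym (count-++ X Y xs as)) (sym (count-++ X Y ys as))
      (+-mono-≤ (p as) (q as))

  duplicate-++ : (X Y : Multiteam 𝔄) (x : Var)
    → duplicate 𝔄 (X ++ Y) x ≡ duplicate 𝔄 X x ++ duplicate 𝔄 Y x
  duplicate-++ X Y x = List.concatMap-++ _ X Y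

  supplement-++ : (X Y : Multiteam 𝔄) (x : Var)
    (F : Fin (length X) → Subset (suc (size 𝔄))) (G : Fin (length Y) → Subset (suc (size 𝔄)))
    → supplement 𝔄 (X ++ Y) x (joinChoice X Y F G)
      ≡ supplement 𝔄 X x F ++ supplement 𝔄 Y x G
  supplement-++ X Y x = positionwise-++
    (λ s S → map (update 𝔄 s x) (filter (λ a → a ∈? S) (allFin _))) X Y

proposition7 : ∀ {σ : Signature} (𝔄 : Structure σ) (φ : Formula σ) (X Y : Multiteam 𝔄)
    → _⊨_ 𝔄 X φ → _⊨_ 𝔄 Y φ → _⊨_ 𝔄 (X ++ Y) φ
proposition7 𝔄 (rel R ts)    X Y p q = ++⁺ p q
proposition7 𝔄 (nrel R ts)   X Y p q = ++⁺ p q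
proposition7 𝔄 (eq t u)      X Y p q = ++⁺ p q
proposition7 𝔄 (neq t u)     X Y p q = ++⁺ p q
proposition7 𝔄 (pincl xs ys) X Y p q = pincl-++ 𝔄 X Y xs ys p q
proposition7 𝔄 (incl xs ys)  X Y p q = allAny-++ (λ s s' → valV 𝔄 s xs ≡ valV 𝔄 s' ys) X Y p q
proposition7 𝔄 (φ ∧' ψ) X Y (pφ , pψ) (qφ , qψ) =
  proposition7 𝔄 φ X Y pφ qφ , proposition7 𝔄 ψ X Y pψ qψ
proposition7 𝔄 (φ ∨' ψ) X Y (Y₁ , Z₁ , X↭ , pφ , pψ) (Y₂ , Z₂ , Y↭ , qφ , qψ) =
  Y₁ ++ Y₂ , Z₁ ++ Z₂ , ↭-trans (Perm.++⁺ X↭ Y↭) (++-interchange Y₁ Z₁ Y₂ Z₂)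
  , proposition7 𝔄 φ Y₁ Y₂ pφ qφ , proposition7 𝔄 ψ Z₁ Z₂ pψ qψ
proposition7 𝔄 (ex x φ) X Y (F , F-nonempty , p) (G , G-nonempty , q) =
  joinChoice X Y F G , joinChoice-all Nonempty X Y F G F-nonempty G-nonempty
  , subst (λ Z → _⊨_ 𝔄 Z φ) (sym (supplement-++ 𝔄 X Y x F G))
      (proposition7 𝔄 φ (supplement 𝔄 X x F) (supplement 𝔄 Y x G) p q)
proposition7 𝔄 (all x φ) X Y p q =
  subst (λ Z → _⊨_ 𝔄 Z φ) (sym (duplicate-++ 𝔄 X Y x))
    (proposition7 𝔄 φ (duplicate 𝔄 X x) (duplicate 𝔄 Y x) p q)
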